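{- Let $H$ be a hypergraph with no isolated vertices, and let $p\in(0,1)$. If every edge in $H$ is flammable with respect to $p$, then $b_{L,p}(H)<b_p(H)$.
   Context: A hypergraph $H=(V(H),E(H))$ has a finite nonempty vertex set and a finite collection $E(H)$ of subsets of $V(H)$ called edges (parallel edges allowed); a vertex is isolated if it lies in no edge. An edge $e$ is non-flammable with respect to $p$ if $\lceil p|e|\rceil=|e|$, and flammable otherwise. For a proportion $p\in(0,1)$, the proportion-based propagation rule is: if at the end of a round at least $\lceil p|e|\rceil$ vertices of an edge $e$ are on fire, then in the next round all vertices of $e$ catch fire; burned vertices stay burned. Burning game: let $F_0=\emptyset$ and $F_r$ be the set of burned vertices at the end of round $r$. In each round $r\geq 1$, simultaneously, vertices catch fire by propagation from $F_{r-1}$ (no propagation in round 1), and a player chooses a vertex $u_r\notin F_{r-1}$ (a source) and sets it on fire. A burning sequence is a sequence $(u_1,\ldots,u_k)$ of such sources after which every vertex is on fire at the end of round $k$; $b_p(H)$ is the minimum length of a burning sequence. Lazy game: $S\subseteq V(H)$ is a lazy burning set if, setting all of $S$ on fire at once and then repeatedly applying the propagation rule, every vertex eventually catches fire; $b_{L,p}(H)$ is the minimum size of a lazy burning set.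
   Formalization: The proportion $p$ ranges over the rationals in $(0,1)$. -}

module Defs where

open import Data.Nat as ℕ using (ℕ; zero; suc; _<_)
open import Data.Integer as ℤ using (ℤ; +_)
open import Data.Rational as ℚ using (ℚ; ceiling; 0ℚ; 1ℚ)
open import Data.Fin using (Fin)
open import Data.Fin.Subset using (Subset; ⊥; ⊤; ⁅_⁆; _∪_; _∩_; _∈_; _∉_; ∣_∣; ⋃)
open import Data.List using (List; []; _∷_; length; filter)
open import Data.List.Relation.Unary.Any using (Any)
open import Data.Bool using (Bool; true; false)
open import Data.Product using (_×_; Σ; ∃)
open import Relation.Binary.PropositionalEquality using (_≡_; _≢_)
open import Relation.Nullary using (¬_)
open import Relation.Nullary.Decidable using (Dec)
open import Data.Integer.Properties using () renaming (_≤?_ to _≤ℤ?_)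

-- A hypergraph on the nonempty vertex set Fin (suc m); edges are a list of
-- subsets (so parallel edges are allowed).
record Hypergraph : Set where
  constructor hypergraph
  field
    m     : ℕ
    edges : List (Subset (suc m))

open Hypergraph public

V : Hypergraph → ℕ
V H = suc (m H)

NoIsolated : Hypergraph → Set
NoIsolated H = (x : Fin (V H)) → Any (λ e → x ∈ e) (edges H)

threshold : ∀ {n} → ℚ → Subset n → ℤ
threshold p e = ceiling (p ℚ.* ((+ ∣ e ∣) ℚ./ 1))

NonFlammable : ∀ {n} → ℚ → Subset n → Set
NonFlammable p e = threshold p e ≡ + ∣ e ∣

Flammable : ∀ {n} → ℚ → Subset n → Set
Flammable p e = ¬ NonFlammable p e

Ignites : ∀ {n} → ℚ → Subset n → Subset n → Set
Ignites p F e = threshold p e ℤ.≤ + ∣ e ∩ F ∣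

ignites? : ∀ {n} (p : ℚ) (F e : Subset n) → Dec (Ignites p F e)
ignites? p F e = threshold p e ≤ℤ? + ∣ e ∩ F ∣

propagate : (H : Hypergraph) → ℚ → Subset (V H) → Subset (V H)
propagate H p F = F ∪ ⋃ (filter (ignites? p F) (edges H))

iterate : ∀ {A : Set} → (A → A) → ℕ → A → A
iterate f zero    a = a
iterate f (suc k) a = f (iterate f k a)

IsLazyBurningSet : (H : Hypergraph) → ℚ → Subset (V H) → Set
IsLazyBurningSet H p S = ∃ λ t → iterate (propagate H p) t S ≡ ⊤

-- burning game.  ValidFrom first F us: F is the burned set at the end of the
-- previous round, `first` says whether the next round is round 1 (no propagation).
ValidFrom : (H : Hypergraph) → ℚ → Bool → Subset (V H) → List (Fin (V H)) → Set
ValidFrom H p b     F []       = F ≡ ⊤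
ValidFrom H p true  F (u ∷ us) = u ∉ F × ValidFrom H p false (F ∪ ⁅ u ⁆) us
ValidFrom H p false F (u ∷ us) = u ∉ F × ValidFrom H p false (propagate H p F ∪ ⁅ u ⁆) us

IsBurningSequence : (H : Hypergraph) → ℚ → List (Fin (V H)) → Set
IsBurningSequence H p us = ValidFrom H p true ⊥ us

IsBurningNumber : Hypergraph → ℚ → ℕ → Set
IsBurningNumber H p k =
  (Σ (List (Fin (V H))) λ us → IsBurningSequence H p us × length us ≡ k)
  × (∀ us → IsBurningSequence H p us → k ℕ.≤ length us)

IsLazyBurningNumber : Hypergraph → ℚ → ℕ → Set
IsLazyBurningNumber H p k =
  (Σ (Subset (V H)) λ S → IsLazyBurningSet H p S × ∣ S ∣ ≡ k)
  × (∀ S → IsLazyBurningSet H p S → k ℕ.≤ ∣ S ∣)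

-- Take a shortest burning sequence u₁ … u_k.  Each fire of the game is also
-- reached by lazily burning the sources, so lazily burning {u₁, …, u_{k-1}}
-- eventually sets on fire every vertex except possibly u_k.  An edge with at
-- most one unburned vertex has at least |e| - 1 ≥ ⌈p|e|⌉ burned ones when it is
-- flammable, so every edge ignites in the next step; as u_k lies in some edge,
-- everything burns.  Hence b_{L,p}(H) ≤ k - 1.
module Submission where

open import Data.Nat as ℕ using (ℕ; zero; suc; _<_)
import Data.Nat.Properties as ℕP
open import Data.Integer as ℤ using (+_)
import Data.Integer.Properties as ℤP
open import Data.Integer.DivMod using (div-pos-is-/ℕ; n<s[n/ℕd]*d)
open import Data.Integer.GCD using (gcd; gcd-zeroʳ)
open import Data.Rational as ℚ using (ℚ; mkℚ; ceiling; floor; 0ℚ; 1ℚ; ↥_; ↧_)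
  renaming (_<_ to _<ℚ_)
import Data.Rational.Properties as ℚP
open import Data.Fin using (Fin)
open import Data.Fin.Subset using (Subset; _⊆_; _∈_; _∪_; _∩_; ⁅_⁆; ∣_∣; ⋃; ⊤)
  renaming (⊥ to ∅)
open import Data.Fin.Subset.Properties
open import Data.List using (List; []; _∷_; length; filter)
open import Data.Vec using ([]; _∷_)
open import Data.List.Relation.Unary.All as All using (All)
open import Data.List.Relation.Unary.Any using (here; there)
open import Data.List.Membership.Propositional using (find) renaming (_∈_ to _∈ᴸ_)
open import Data.Bool using (Bool; true; false)
open import Data.Product using (∃; _×_; _,_; proj₁; proj₂)
open import Data.Sum using (_⊎_; inj₁; inj₂; [_,_]; map₁; map₂)
open import Relation.Binary.PropositionalEquality hiding ([_])
open import Relation.Nullary using (yes; no; contradiction)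
open import Relation.Unary using (Pred; Decidable)

open import Defs

private
  variable
    n : ℕ

i<suc[j]⇒i≤j : ∀ {i j} → i ℤ.< ℤ.suc j → i ℤ.≤ j
i<suc[j]⇒i≤j {j = j} i<1+j = subst (_ ℤ.≤_) (ℤP.pred-suc j) (ℤP.i<j⇒i≤pred[j] i<1+j)

floor-greatest : ∀ i y → i ℤ.* ↧ y ℤ.≤ ↥ y → i ℤ.≤ floor y
floor-greatest i (mkℚ a d-1 _) i*d≤a =
  subst (i ℤ.≤_) (sym (div-pos-is-/ℕ a d)) (i<suc[j]⇒i≤j i<1+q)
  where
  d : ℕ
  d = suc d-1
  i<1+q : i ℤ.< ℤ.suc (a ℤ./ℕ d)
  i<1+q = ℤP.*-cancelʳ-<-nonNeg (+ d) (ℤP.≤-<-trans i*d≤a (n<s[n/ℕd]*d a d))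

ceiling-least : ∀ i x → ↥ x ℤ.≤ i ℤ.* ↧ x → ceiling x ℤ.≤ i
ceiling-least i x@(mkℚ _ _ _) a≤i*d =
  subst (ℤ.- floor (ℚ.- x) ℤ.≤_) (ℤP.neg-involutive i)
    (ℤP.neg-mono-≤ (floor-greatest (ℤ.- i) (ℚ.- x) -i*d≤-a))
  where
  open ℤP.≤-Reasoning
  -i*d≤-a : ℤ.- i ℤ.* ↧ (ℚ.- x) ℤ.≤ ↥ (ℚ.- x)
  -i*d≤-a = begin
    ℤ.- i ℤ.* ↧ (ℚ.- x) ≡⟨ cong (ℤ.- i ℤ.*_) (ℚP.↧-neg x) ⟩
    ℤ.- i ℤ.* ↧ x       ≡⟨ ℤP.neg-distribˡ-* i (↧ x) ⟨
    ℤ.- (i ℤ.* ↧ x)     ≤⟨ ℤP.neg-mono-≤ a≤i*d ⟩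
    ℤ.- ↥ x             ≡⟨ ℚP.↥-neg x ⟨
    ↥ (ℚ.- x)           ∎

↥[i/1]≡i : ∀ i → ↥ (i ℚ./ 1) ≡ i
↥[i/1]≡i i = begin
  ↥ (i ℚ./ 1)                  ≡⟨ ℤP.*-identityʳ _ ⟨
  ↥ (i ℚ./ 1) ℤ.* + 1          ≡⟨ cong (↥ (i ℚ./ 1) ℤ.*_) (gcd-zeroʳ i) ⟨
  ↥ (i ℚ./ 1) ℤ.* gcd i (+ 1)  ≡⟨ ℚP.↥-/ i 1 ⟩
  i                            ∎
  where open ≡-Reasoning

↧[i/1]≡1 : ∀ i → ↧ (i ℚ./ 1) ≡ + 1
↧[i/1]≡1 i = begin
  ↧ (i ℚ./ 1)                  ≡⟨ ℤP.*-identityʳ _ ⟨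
  ↧ (i ℚ./ 1) ℤ.* + 1          ≡⟨ cong (↧ (i ℚ./ 1) ℤ.*_) (gcd-zeroʳ i) ⟨
  ↧ (i ℚ./ 1) ℤ.* gcd i (+ 1)  ≡⟨ ℚP.↧-/ i 1 ⟩
  + 1                          ∎
  where open ≡-Reasoning

x≤i/1⇒⌈x⌉≤i : ∀ {x} i → x ℚ.≤ i ℚ./ 1 → ceiling x ℤ.≤ i
x≤i/1⇒⌈x⌉≤i {x} i (ℚ.*≤* le) = ceiling-least i x (subst₂ ℤ._≤_ ↥x*1≡↥x (cong (ℤ._* ↧ x) (↥[i/1]≡i i)) le)
  where
  ↥x*1≡↥x : ↥ x ℤ.* ↧ (i ℚ./ 1) ≡ ↥ x
  ↥x*1≡↥x = trans (cong (↥ x ℤ.*_) (↧[i/1]≡1 i)) (ℤP.*-identityʳ (↥ x))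

∪-lub : ∀ {p q r : Subset n} → p ⊆ r → q ⊆ r → p ∪ q ⊆ r
∪-lub {p = p} {q} p⊆r q⊆r x∈p∪q = [ p⊆r , q⊆r ] (x∈p∪q⁻ p q x∈p∪q)

∩-monoʳ-⊆ : ∀ (e : Subset n) {p q} → p ⊆ q → e ∩ p ⊆ e ∩ q
∩-monoʳ-⊆ e {p} p⊆q x∈e∩p with x∈p∩q⁻ e p x∈e∩p
... | x∈e , x∈p = x∈p∩q⁺ (x∈e , p⊆q x∈p)

∣p∪q∣≤∣p∣+∣q∣ : ∀ (p q : Subset n) → ∣ p ∪ q ∣ ℕ.≤ ∣ p ∣ ℕ.+ ∣ q ∣
∣p∪q∣≤∣p∣+∣q∣ []          []          = ℕ.z≤n
∣p∪q∣≤∣p∣+∣q∣ (true  ∷ p) (s     ∷ q) = ℕ.s≤s (ℕP.≤-trans (∣p∪q∣≤∣p∣+∣q∣ p q) (ℕP.+-monoʳ-≤ ∣ p ∣ (∣p∣≤∣x∷p∣ s q)))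
∣p∪q∣≤∣p∣+∣q∣ (false ∷ p) (true  ∷ q) = subst (suc ∣ p ∪ q ∣ ℕ.≤_) (sym (ℕP.+-suc ∣ p ∣ ∣ q ∣)) (ℕ.s≤s (∣p∪q∣≤∣p∣+∣q∣ p q))
∣p∪q∣≤∣p∣+∣q∣ (false ∷ p) (false ∷ q) = ∣p∪q∣≤∣p∣+∣q∣ p q

∣⁅x⁆∪p∣≤1+∣p∣ : ∀ (x : Fin n) p → ∣ ⁅ x ⁆ ∪ p ∣ ℕ.≤ suc ∣ p ∣
∣⁅x⁆∪p∣≤1+∣p∣ x p = subst (λ k → ∣ ⁅ x ⁆ ∪ p ∣ ℕ.≤ k ℕ.+ ∣ p ∣) (∣⁅x⁆∣≡1 x) (∣p∪q∣≤∣p∣+∣q∣ ⁅ x ⁆ p)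

module _ {ℓ} {P : Pred (Subset n) ℓ} (P? : Decidable P) where

  ∈⋃filter⁺ : ∀ {x e es} → e ∈ᴸ es → P e → x ∈ e → x ∈ ⋃ (filter P? es)
  ∈⋃filter⁺ {e = e} (here refl) Pe x∈e with P? e
  ... | yes _   = p⊆p∪q _ x∈e
  ... | no ¬Pe  = contradiction Pe ¬Pe
  ∈⋃filter⁺ {es = e ∷ es} (there e∈es) Pe x∈e with P? e
  ... | yes _ = q⊆p∪q e _ (∈⋃filter⁺ e∈es Pe x∈e)
  ... | no _  = ∈⋃filter⁺ e∈es Pe x∈e

  ∈⋃filter⁻ : ∀ {x} es → x ∈ ⋃ (filter P? es) → ∃ λ e → e ∈ᴸ es × P e × x ∈ e
  ∈⋃filter⁻ []       x∈∅ = contradiction x∈∅ ∉⊥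
  ∈⋃filter⁻ (e ∷ es) x∈⋃ with P? e
  ... | no _  = let e′ , e′∈es , Pe′ , x∈e′ = ∈⋃filter⁻ es x∈⋃ in e′ , there e′∈es , Pe′ , x∈e′
  ... | yes Pe with x∈p∪q⁻ e _ x∈⋃
  ...   | inj₁ x∈e = e , here refl , Pe , x∈e
  ...   | inj₂ x∈⋃′ = let e′ , e′∈es , Pe′ , x∈e′ = ∈⋃filter⁻ es x∈⋃′ in e′ , there e′∈es , Pe′ , x∈e′

MissesAtMost : Fin n → Subset n → Set
MissesAtMost w A = ∀ x → x ∈ A ⊎ x ≡ w

MissesAtMost-mono : ∀ {w} {A B : Subset n} → A ⊆ B → MissesAtMost w A → MissesAtMost w B
MissesAtMost-mono A⊆B A-misses x = map₁ A⊆B (A-misses x)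

A∪⁅w⁆≡⊤⇒MissesAtMost : ∀ {w} {A : Subset n} → A ∪ ⁅ w ⁆ ≡ ⊤ → MissesAtMost w A
A∪⁅w⁆≡⊤⇒MissesAtMost {w = w} {A} eq x =
  map₂ (x∈⁅y⁆⇒x≡y w) (x∈p∪q⁻ A ⁅ w ⁆ (subst (x ∈_) (sym eq) ∈⊤))

∣e∣≤1+∣e∩A∣ : ∀ {w} {A : Subset n} e → MissesAtMost w A → ∣ e ∣ ℕ.≤ suc ∣ e ∩ A ∣
∣e∣≤1+∣e∩A∣ {w = w} {A} e A-misses = ℕP.≤-trans (p⊆q⇒∣p∣≤∣q∣ e⊆⁅w⁆∪e∩A) (∣⁅x⁆∪p∣≤1+∣p∣ w (e ∩ A))
  where
  e⊆⁅w⁆∪e∩A : e ⊆ ⁅ w ⁆ ∪ (e ∩ A)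
  e⊆⁅w⁆∪e∩A {x} x∈e with A-misses x
  ... | inj₁ x∈A  = q⊆p∪q ⁅ w ⁆ _ (x∈p∩q⁺ (x∈e , x∈A))
  ... | inj₂ refl = p⊆p∪q _ (x∈⁅x⁆ x)

iterate-suc-inside : ∀ {A : Set} (f : A → A) t a → iterate f t (f a) ≡ iterate f (suc t) a
iterate-suc-inside f zero    a = refl
iterate-suc-inside f (suc t) a = cong f (iterate-suc-inside f t a)

iterate-mono : ∀ {f : Subset n → Subset n} → (∀ {A B} → A ⊆ B → f A ⊆ f B) →
               ∀ t {A B} → A ⊆ B → iterate f t A ⊆ iterate f t B
iterate-mono f-mono zero    A⊆B = A⊆B
iterate-mono f-mono (suc t) A⊆B = f-mono (iterate-mono f-mono t A⊆B)

allButLast : Fin n → List (Fin n) → Subset n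
allButLast u []       = ∅
allButLast u (w ∷ ws) = ⁅ u ⁆ ∪ allButLast w ws

lastOf : Fin n → List (Fin n) → Fin n
lastOf u []       = u
lastOf u (w ∷ ws) = lastOf w ws

∣allButLast∣≤length : ∀ (u : Fin n) us → ∣ allButLast u us ∣ ℕ.≤ length us
∣allButLast∣≤length {n} u []       = ℕP.≤-reflexive (∣⊥∣≡0 n)
∣allButLast∣≤length     u (w ∷ ws) = ℕP.≤-trans (∣⁅x⁆∪p∣≤1+∣p∣ u _) (ℕ.s≤s (∣allButLast∣≤length w ws))

threshold<∣e∣ : ∀ {p} (e : Subset n) → p ℚ.≤ 1ℚ → Flammable p e → threshold p e ℤ.< + ∣ e ∣
threshold<∣e∣ {p = p} e p≤1 flammable = ℤP.≤∧≢⇒< (x≤i/1⇒⌈x⌉≤i (+ ∣ e ∣) p*∣e∣≤∣e∣) flammable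
  where
  ∣e∣ : ℚ
  ∣e∣ = + ∣ e ∣ ℚ./ 1
  p*∣e∣≤∣e∣ : p ℚ.* ∣e∣ ℚ.≤ ∣e∣
  p*∣e∣≤∣e∣ = subst (p ℚ.* ∣e∣ ℚ.≤_) (ℚP.*-identityˡ ∣e∣)
                (ℚP.*-monoʳ-≤-nonNeg ∣e∣ {{ℚP.normalize-nonNeg ∣ e ∣ 1}} p≤1)

flammable-ignites : ∀ {p w} {A : Subset n} e → p ℚ.≤ 1ℚ → Flammable p e → MissesAtMost w A → Ignites p A e
flammable-ignites e p≤1 flammable A-misses =
  i<suc[j]⇒i≤j (ℤP.<-≤-trans (threshold<∣e∣ e p≤1 flammable) (ℤ.+≤+ (∣e∣≤1+∣e∩A∣ e A-misses)))

Ignites-mono : ∀ {p} {A B : Subset n} e → A ⊆ B → Ignites p A e → Ignites p B e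
Ignites-mono e A⊆B θ≤∣e∩A∣ = ℤP.≤-trans θ≤∣e∩A∣ (ℤ.+≤+ (p⊆q⇒∣p∣≤∣q∣ (∩-monoʳ-⊆ e A⊆B)))

module _ (H : Hypergraph) (p : ℚ) where

  propagate-inflationary : ∀ A → A ⊆ propagate H p A
  propagate-inflationary A = p⊆p∪q _

  propagate-mono : ∀ {A B} → A ⊆ B → propagate H p A ⊆ propagate H p B
  propagate-mono {A} {B} A⊆B = ∪-lub (⊆-trans A⊆B (propagate-inflationary B)) ignited⊆
    where
    ignited⊆ : ⋃ (filter (ignites? p A) (edges H)) ⊆ propagate H p B
    ignited⊆ x∈⋃ =
      let e , e∈edges , ignites , x∈e = ∈⋃filter⁻ (ignites? p A) (edges H) x∈⋃
      in q⊆p∪q B _ (∈⋃filter⁺ (ignites? p B) e∈edges (Ignites-mono {p = p} e A⊆B ignites) x∈e)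

  propagate-fills : ∀ {w A} → p ℚ.≤ 1ℚ → NoIsolated H → All (Flammable p) (edges H) →
                    MissesAtMost w A → propagate H p A ≡ ⊤
  propagate-fills {w} {A} p≤1 noIsolated flammable A-misses =
    ⊆-antisym ⊆⊤ (λ {x} _ → [ propagate-inflationary A , (λ { refl → w-ignited }) ] (A-misses x))
    where
    w-ignited : w ∈ propagate H p A
    w-ignited =
      let e , e∈edges , w∈e = find (noIsolated w)
          ignites = flammable-ignites e p≤1 (All.lookup flammable e∈edges) A-misses
      in q⊆p∪q A _ (∈⋃filter⁺ (ignites? p A) e∈edges ignites w∈e)

  spread : Bool → Subset (V H) → Subset (V H)
  spread true  F = F
  spread false F = propagate H p F

  spread⊆propagate : ∀ first F → spread first F ⊆ propagate H p F
  spread⊆propagate true  F = propagate-inflationary F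
  spread⊆propagate false F = ⊆-refl

  ValidFrom-∷ : ∀ first F u us → ValidFrom H p first F (u ∷ us) →
                ValidFrom H p false (spread first F ∪ ⁅ u ⁆) us
  ValidFrom-∷ true  F u us = proj₂
  ValidFrom-∷ false F u us = proj₂

  -- A round of the game adds its source and spreads the fire by at most one
  -- propagation step, so the game never gets ahead of lazy burning.
  ValidFrom⇒lazy-misses-last : ∀ first F u us → ValidFrom H p first F (u ∷ us) →
    ∃ λ t → MissesAtMost (lastOf u us) (iterate (propagate H p) t (F ∪ allButLast u us))
  ValidFrom⇒lazy-misses-last first F u [] valid =
    1 , MissesAtMost-mono (⊆-trans (spread⊆propagate first F) (propagate-mono (p⊆p∪q ∅)))
                          (A∪⁅w⁆≡⊤⇒MissesAtMost (ValidFrom-∷ first F u [] valid))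
  ValidFrom⇒lazy-misses-last first F u (w ∷ ws) valid =
    let t , misses = ValidFrom⇒lazy-misses-last false (spread first F ∪ ⁅ u ⁆) w ws
                       (ValidFrom-∷ first F u (w ∷ ws) valid)
    in suc t , MissesAtMost-mono (⊆-trans (iterate-mono propagate-mono t next-round)
                                          (⊆-reflexive (iterate-suc-inside (propagate H p) t _))) misses
    where
    S : Subset (V H)
    S = ⁅ u ⁆ ∪ allButLast w ws
    S⊆ : S ⊆ propagate H p (F ∪ S)
    S⊆ = ⊆-trans (q⊆p∪q F S) (propagate-inflationary _)
    next-round : (spread first F ∪ ⁅ u ⁆) ∪ allButLast w ws ⊆ propagate H p (F ∪ S)
    next-round = ∪-lub (∪-lub (⊆-trans (spread⊆propagate first F) (propagate-mono (p⊆p∪q S)))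
                              (⊆-trans (p⊆p∪q _) S⊆))
                       (⊆-trans (q⊆p∪q ⁅ u ⁆ _) S⊆)

theorem2p15 : (H : Hypergraph) (p : ℚ) → 0ℚ <ℚ p → p <ℚ 1ℚ → NoIsolated H → All (Flammable p) (edges H) → (bL b : ℕ) → IsLazyBurningNumber H p bL → IsBurningNumber H p b → bL < b
theorem2p15 H p _ p<1 noIsolated flammable bL b (_ , lazy-minimal) ((u ∷ us , burning , refl) , _) =
  ℕ.s≤s (ℕP.≤-trans (lazy-minimal S (suc t , fills)) (∣allButLast∣≤length u us))
  where
  S : Subset (V H)
  S = allButLast u us
  lazily-all-but-last : ∃ λ t → MissesAtMost (lastOf u us) (iterate (propagate H p) t S)
  lazily-all-but-last = subst (λ A → ∃ λ t → MissesAtMost (lastOf u us) (iterate (propagate H p) t A))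
                          (∪-identityˡ S) (ValidFrom⇒lazy-misses-last H p true ∅ u us burning)
  t : ℕ
  t = proj₁ lazily-all-but-last
  fills : propagate H p (iterate (propagate H p) t S) ≡ ⊤
  fills = propagate-fills H p (ℚP.<⇒≤ p<1) noIsolated flammable (proj₂ lazily-all-but-last)
theorem2p15 _ _ _ _ _ _ _ _ _ (([] , () , _) , _)
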